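{- Let $t\ge1$ and let $f:\{0,1\}^n\to\{0,1\}$ be given by a compact form DNF representation of size $d_\vee$ and width $d_\wedge$ with the $t$-block property. Then $$\mathrm{s}(f)\ge\left\lceil\frac{d_\vee}{3td_\wedge-2t-d_\wedge+1}\right\rceil.$$
   Context: For $x\in\{0,1\}^n$, $x^i$ flips bit $i$ and $x^B$ flips bits in $B\subseteq[n]$. $\mathrm{s}(f,x)=|\{i: f(x)\neq f(x^i)\}|$, $\mathrm{s}(f)=\max_x\mathrm{s}(f,x)$. $\mathrm{bs}(f,x)$ is the maximum number of pairwise disjoint $B\subseteq[n]$ with $f(x^B)\ne f(x)$; $\mathrm{bs}_0(f)=\max_{f(x)=0}\mathrm{bs}(f,x)$. A DNF representation is an OR of $d_\vee$ terms $\wedge_1,\dots,\wedge_{d_\vee}$, each an AND of literals, no term containing a variable and its negation; $A_i$ (resp. $\overline{A}_i$) is the set of variables unnegated (resp. negated) in $\wedge_i$; width $d_\wedge=\max_i(|A_i|+|\overline{A}_i|)$; $S_i$ is the set of assignments satisfying $\wedge_i$. Compact form: (a) $f(0^n)=0$, (b) $\mathrm{bs}_0(f)=\mathrm{bs}(f,0^n)$, (c) $S_i\setminus\bigcup_{j\ne i}S_j\ne\emptyset$ for all $i$. $t$-block property: every variable lies in $A_i$ for at most $t$ indices $i$. -}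

module Defs where

open import Data.Nat using (ℕ; zero; suc; _+_; _≤_; _⊔_)
open import Data.Bool using (Bool; true; false; _∧_; _∨_; not; _xor_; if_then_else_)
open import Data.Fin using (Fin)
open import Data.Vec using (Vec; []; _∷_; lookup; zipWith; replicate; foldr; map)
import Data.List as List
open import Data.List using (List; allFin)
open import Data.Fin.Subset using (Subset; ⁅_⁆; _∈_; _∩_; ∣_∣; Empty)
open import Data.Product using (Σ; _×_; ∃)
open import Relation.Binary.PropositionalEquality using (_≡_; _≢_)

-- Inputs x ∈ {0,1}^n are Boolean vectors (true = 1).
Input : ℕ → Set
Input n = Vec Bool n

flip : ∀ {n} → Input n → Subset n → Input n
flip x B = zipWith _xor_ x B

flipBit : ∀ {n} → Input n → Fin n → Input n
flipBit x i = flip x ⁅ i ⁆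

zeros : ∀ n → Input n
zeros n = replicate n false

allInputs : ∀ n → List (Input n)
allInputs zero = List.[ [] ]
allInputs (suc n) = List.map (true ∷_) (allInputs n) List.++ List.map (false ∷_) (allInputs n)

maxList : List ℕ → ℕ
maxList = List.foldr _⊔_ 0

sensAt : ∀ {n} → (Input n → Bool) → Input n → ℕ
sensAt {n} f x = List.length (List.filter (λ i → Data.Bool._≟_ (f x xor f (flipBit x i)) true) (allFin n))
  where import Data.Bool

sens : ∀ {n} → (Input n → Bool) → ℕ
sens {n} f = maxList (List.map (sensAt f) (allInputs n))

-- A family of k pairwise disjoint blocks B₁..B_k, each with f(x^B) ≠ f(x).
-- bs(f,x) is the largest k for which such a family exists.
record SensitiveBlocks {n} (f : Input n → Bool) (x : Input n) (k : ℕ) : Set where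
  field
    block    : Fin k → Subset n
    disjoint : ∀ a b → a ≢ b → Empty (block a ∩ block b)
    flips    : ∀ a → f (flip x (block a)) ≢ f x

record Term (n : ℕ) : Set where
  field
    pos  : Subset n
    neg  : Subset n
    consistent : Empty (pos ∩ neg)
open Term public

evalTerm : ∀ {n} → Term n → Input n → Bool
evalTerm T x = foldr _ _∧_ true
  (zipWith _∧_ (zipWith (λ p b → not p ∨ b) (pos T) x)
               (zipWith (λ q b → not q ∨ not b) (neg T) x))

DNF : ℕ → ℕ → Set
DNF n m = Vec (Term n) m

evalDNF : ∀ {n m} → DNF n m → Input n → Bool
evalDNF D x = foldr _ _∨_ false (map (λ T → evalTerm T x) D)

width : ∀ {n m} → DNF n m → ℕ
width D = foldr _ _⊔_ 0 (map (λ T → ∣ pos T ∣ + ∣ neg T ∣) D)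

record CompactForm {n m} (D : DNF n m) : Set where
  field
    zeroAtZero : evalDNF D (zeros n) ≡ false
    -- bs₀(f) = bs(f,0ⁿ): every sensitive block family at a 0-input is matched at 0ⁿ
    bsAtZero   : ∀ x k → evalDNF D x ≡ false →
                 SensitiveBlocks (evalDNF D) x k → SensitiveBlocks (evalDNF D) (zeros n) k
    uniqueSat  : ∀ i → ∃ λ x → evalTerm (lookup D i) x ≡ true ×
                   (∀ j → j ≢ i → evalTerm (lookup D j) x ≡ false)

tBlock : ∀ {n m} → ℕ → DNF n m → Set
tBlock {n} t D = ∀ (v : Fin n) →
  foldr _ _+_ 0 (map (λ T → if lookup (pos T) v then 1 else 0) D) ≤ t

-- Call terms i ≠ j of the DNF conflicting if they share an unnegated variable or an
-- unnegated variable of one is negated in the other. For a conflict-free set J of terms,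
-- start at 0ⁿ (where f = 0) and switch on variables of ⋃_{j∈J} A_j one at a time as long
-- as f stays 0. At the final 0-input x every still-unset variable of that union is
-- sensitive. No negated variable of a term in J lies in the union, so each term of J,
-- being unsatisfied at x, has an unset unnegated variable, and these are distinct; hence
-- s(f) ≥ |J|. The t-block property and the width bound give every induced subgraph of the
-- conflict graph average degree at most K = 3tw − 2t − w, so greedily taking a vertex of
-- degree ≤ K and discarding its neighbours finds a conflict-free J with d∨ ≤ (K + 1)|J|.

module Submission where

open import Defs
open import Data.Nat using (ℕ; _≤_)
open import Data.Integer using (ℤ; +_; _-_; _*_) renaming (_≤_ to _≤ℤ_; _+_ to _+ℤ_)

import Data.Nat as ℕ
open import Data.Nat using (zero; suc; _+_; _<_; _⊔_; z≤n; s≤s)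
open import Data.Nat.Induction using (<-wellFounded)
open import Data.Nat.Tactic.RingSolver using (solve-∀)
import Data.Nat.Properties as ℕₚ
import Data.Integer as ℤ
import Data.Integer.Properties as ℤₚ
import Data.Integer.Tactic.RingSolver as ℤ-Solver
open import Data.Bool using (Bool; true; false; _∧_; _∨_; not; _xor_; if_then_else_)
open import Data.Bool.Properties
  using (∧-identityʳ; ∧-zeroʳ; ∧-comm; ∨-zeroʳ; ∨-comm; ¬-not; not-injective)
  renaming (_≟_ to _≟ᵇ_)
open import Data.Fin using (Fin; zero; suc)
open import Data.Fin.Properties using (_≟_; any?; 0≢1+n; suc-injective)
open import Data.Fin.Subset using (Subset; ⁅_⁆; ∣_∣)
open import Data.Fin.Subset.Properties using (x∈⁅x⁆; x≢y⇒x∉⁅y⁆; x∈p∩q⁺)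
open import Data.Vec using (Vec; []; _∷_; lookup; foldr; zipWith)
import Data.Vec as Vec
open import Data.Vec.Properties using (lookup-zipWith; lookup-replicate; []=⇒lookup; lookup⇒[]=)
import Data.List as List
open import Data.List using ([]; _∷_)
open import Data.List.Membership.Propositional using (_∈_)
open import Data.List.Membership.Propositional.Properties using (∈-map⁺; ∈-++⁺ˡ; ∈-++⁺ʳ)
open import Data.List.Relation.Unary.Any using (here; there)
open import Data.Product using (∃; _×_; _,_; proj₁; proj₂)
open import Data.Sum using (_⊎_; inj₁; inj₂)
open import Data.Empty using (⊥)
open import Function using (_∘_)
open import Induction.WellFounded using (Acc; acc)
open import Relation.Unary using (Pred; Decidable)
open import Relation.Nullary using (¬_; Dec; does; yes; no; contradiction)
open import Relation.Nullary.Decidable using (dec-true; dec-false; _×-dec_)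
open import Relation.Binary.PropositionalEquality
open import Algebra.Properties.Semiring.Sum ℕₚ.+-*-semiring
  using (sum; ∑-comm; ∑-distrib-+; *-distribˡ-sum; *-distribʳ-sum; sum-cong-≗)

infix 4 _⊆_ _≡ᵇ_
infixl 7 _∩_
infixl 6 _∪_ _∖_

-- Subsets of Fin m as Boolean predicates

𝟙 : Bool → ℕ
𝟙 b = if b then 1 else 0

count : ∀ {m} → (Fin m → Bool) → ℕ
count p = sum (𝟙 ∘ p)

_⊆_ : ∀ {m} → (Fin m → Bool) → (Fin m → Bool) → Set
p ⊆ q = ∀ i → p i ≡ true → q i ≡ true

_∩_ _∪_ _∖_ : ∀ {m} → (Fin m → Bool) → (Fin m → Bool) → Fin m → Bool
(p ∩ q) i = p i ∧ q i
(p ∪ q) i = p i ∨ q i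
(p ∖ q) i = p i ∧ not (q i)

_≡ᵇ_ : ∀ {m} → Fin m → Fin m → Bool
i ≡ᵇ j = does (i ≟ j)

≡ᵇ-refl : ∀ {m} (i : Fin m) → (i ≡ᵇ i) ≡ true
≡ᵇ-refl i = dec-true (i ≟ i) refl

dec-true⁻ : ∀ {a} {A : Set a} (a? : Dec A) → does a? ≡ true → A
dec-true⁻ (yes a) _ = a

≡ᵇ⇒≡ : ∀ {m} {i j : Fin m} → (i ≡ᵇ j) ≡ true → i ≡ j
≡ᵇ⇒≡ {i = i} {j} = dec-true⁻ (i ≟ j)

∧-true⁻ : ∀ {a b} → a ∧ b ≡ true → a ≡ true × b ≡ true
∧-true⁻ {true} {true} _ = refl , refl

∖-true⁻ : ∀ {a b} → a ∧ not b ≡ true → a ≡ true × b ≡ false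
∖-true⁻ {true} {false} _ = refl , refl

∨-true⁻ : ∀ {a b} → a ∨ b ≡ true → a ≡ true ⊎ b ≡ true
∨-true⁻ {true} _ = inj₁ refl
∨-true⁻ {false} h = inj₂ h

∑-mono-≤ : ∀ {m} {f g : Fin m → ℕ} → (∀ i → f i ≤ g i) → sum f ≤ sum g
∑-mono-≤ {zero} f≤g = z≤n
∑-mono-≤ {suc m} f≤g = ℕₚ.+-mono-≤ (f≤g zero) (∑-mono-≤ (f≤g ∘ suc))

∑-mono-< : ∀ {m} {f g : Fin m → ℕ} → (∀ i → f i ≤ g i) → ∀ j → f j < g j → sum f < sum g
∑-mono-< f≤g zero fj<gj = ℕₚ.+-mono-<-≤ fj<gj (∑-mono-≤ (f≤g ∘ suc))
∑-mono-< f≤g (suc j) fj<gj = ℕₚ.+-mono-≤-< (f≤g zero) (∑-mono-< (f≤g ∘ suc) j fj<gj)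

∑-*-distribˡ-+ : ∀ {m} (w f g : Fin m → ℕ) →
  sum (λ i → w i ℕ.* (f i + g i)) ≡ sum (λ i → w i ℕ.* f i) + sum (λ i → w i ℕ.* g i)
∑-*-distribˡ-+ w f g =
  trans (sum-cong-≗ (λ i → ℕₚ.*-distribˡ-+ (w i) (f i) (g i)))
        (∑-distrib-+ (λ i → w i ℕ.* f i) (λ i → w i ℕ.* g i))

count-mono : ∀ {m} {p q : Fin m → Bool} → p ⊆ q → count p ≤ count q
count-mono p⊆q = ∑-mono-≤ (λ i → 𝟙-mono (p⊆q i))
  where
  𝟙-mono : ∀ {a b} → (a ≡ true → b ≡ true) → 𝟙 a ≤ 𝟙 b
  𝟙-mono {false} _ = z≤n
  𝟙-mono {true} a⇒b rewrite a⇒b refl = ℕₚ.≤-refl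

count-none : ∀ {m} {p : Fin m → Bool} → (∀ i → p i ≡ false) → count p ≡ 0
count-none {zero} _ = refl
count-none {suc m} none rewrite none zero = count-none (none ∘ suc)

count-all : ∀ {m} → count {m} (λ _ → true) ≡ m
count-all {zero} = refl
count-all {suc m} = cong suc count-all

count-split : ∀ {m} (p q : Fin m → Bool) → count p ≡ count (p ∩ q) + count (p ∖ q)
count-split p q =
  trans (sum-cong-≗ (λ i → 𝟙-split (p i) (q i))) (∑-distrib-+ (𝟙 ∘ (p ∩ q)) (𝟙 ∘ (p ∖ q)))
  where
  𝟙-split : ∀ a b → 𝟙 a ≡ 𝟙 (a ∧ b) + 𝟙 (a ∧ not b)
  𝟙-split false _ = refl
  𝟙-split true false = refl
  𝟙-split true true = refl

count-at : ∀ {m} (p : Fin m → Bool) c → count (p ∩ (_≡ᵇ c)) ≡ 𝟙 (p c)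
count-at {suc m} p zero =
  trans (cong₂ _+_ (cong 𝟙 (∧-identityʳ (p zero))) (count-none (λ i → ∧-zeroʳ (p (suc i)))))
        (ℕₚ.+-identityʳ (𝟙 (p zero)))
count-at {suc m} p (suc c) =
  cong₂ _+_ (cong 𝟙 (∧-zeroʳ (p zero))) (count-at (p ∘ suc) c)

count-pick : ∀ {m} (p : Fin m → Bool) c → count p ≡ 𝟙 (p c) + count (p ∖ (_≡ᵇ c))
count-pick p c = trans (count-split p (_≡ᵇ c)) (cong (_+ count (p ∖ (_≡ᵇ c))) (count-at p c))

count-remove : ∀ {m} {p : Fin m → Bool} {c} → p c ≡ true → count p ≡ suc (count (p ∖ (_≡ᵇ c)))
count-remove {p = p} {c} pc = trans (count-pick p c) (cong (λ b → 𝟙 b + count (p ∖ (_≡ᵇ c))) pc)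

count-insert : ∀ {m} {p : Fin m → Bool} {c} → p c ≡ false → count (p ∪ (_≡ᵇ c)) ≡ suc (count p)
count-insert {p = p} {c} pc = begin
  count (p ∪ (_≡ᵇ c))                           ≡⟨ count-pick (p ∪ (_≡ᵇ c)) c ⟩
  𝟙 (p c ∨ (c ≡ᵇ c)) + count ((p ∪ (_≡ᵇ c)) ∖ (_≡ᵇ c))
    ≡⟨ cong₂ _+_ (trans (cong (λ b → 𝟙 (p c ∨ b)) (≡ᵇ-refl c)) (cong 𝟙 (∨-zeroʳ (p c))))
                 (sum-cong-≗ (λ i → cong 𝟙 (∪-∖ (p i) (i ≡ᵇ c)))) ⟩
  suc (count (p ∖ (_≡ᵇ c)))                     ≡⟨ cong (λ b → suc (𝟙 b + count (p ∖ (_≡ᵇ c)))) pc ⟨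
  suc (𝟙 (p c) + count (p ∖ (_≡ᵇ c)))           ≡⟨ cong suc (count-pick p c) ⟨
  suc (count p)                                 ∎
  where
  open ≡-Reasoning
  ∪-∖ : ∀ a b → (a ∨ b) ∧ not b ≡ a ∧ not b
  ∪-∖ false false = refl
  ∪-∖ false true = refl
  ∪-∖ true false = refl
  ∪-∖ true true = refl

count≤1 : ∀ {m} {p : Fin m → Bool} → (∀ {i j} → p i ≡ true → p j ≡ true → i ≡ j) → count p ≤ 1
count≤1 {zero} _ = z≤n
count≤1 {suc m} {p} unique with p zero in p0
... | true = ℕₚ.≤-reflexive (cong suc (count-none others))
  where
  others : ∀ i → p (suc i) ≡ false
  others i = ¬-not (λ psi → 0≢1+n (unique p0 psi))
... | false = count≤1 (λ pi pj → suc-injective (unique pi pj))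

count≤𝟙 : ∀ {m} {p : Fin m → Bool} {b} → (∀ {i j} → p i ≡ true → p j ≡ true → i ≡ j) →
  (∀ i → p i ≡ true → b ≡ true) → count p ≤ 𝟙 b
count≤𝟙 {b = true} unique _ = count≤1 unique
count≤𝟙 {b = false} _ p⇒b =
  ℕₚ.≤-reflexive (count-none (λ i → ¬-not (λ pi → contradiction (p⇒b i pi) λ ())))

count-pos : ∀ {m} {p : Fin m → Bool} {i} → p i ≡ true → 1 ≤ count p
count-pos {p = p} pi rewrite count-remove {p = p} pi = s≤s z≤n

1≤count : ∀ {m} {p : Fin m → Bool} → ¬ (∀ i → p i ≡ false) → 1 ≤ count p
1≤count {p = p} notNone with any? (λ i → p i ≟ᵇ true)
... | yes (i , pi) = count-pos {p = p} pi
... | no none = contradiction (λ i → ¬-not (λ pi → none (i , pi))) notNone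

below-average : ∀ {m} (L : Fin m → Bool) (d : Fin m → ℕ) K {i} → L i ≡ true →
  sum (λ j → 𝟙 (L j) ℕ.* d j) ≤ count L ℕ.* K → ∃ λ c → L c ≡ true × d c ≤ K
below-average L d K {i} Li average with any? (λ c → (L c ≟ᵇ true) ×-dec (d c ℕₚ.≤? K))
... | yes found = found
... | no none = contradiction average (ℕₚ.<⇒≱ (begin-strict
    count L ℕ.* K                ≡⟨ *-distribʳ-sum K (𝟙 ∘ L) ⟩
    sum (λ j → 𝟙 (L j) ℕ.* K)    <⟨ ∑-mono-< above i above-at-i ⟩
    sum (λ j → 𝟙 (L j) ℕ.* d j)  ∎))
  where
  open ℕₚ.≤-Reasoning
  exceeds : ∀ {j} → L j ≡ true → K < d j
  exceeds {j} Lj = ℕₚ.≰⇒> (λ dj≤K → none (j , Lj , dj≤K))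
  above : ∀ j → 𝟙 (L j) ℕ.* K ≤ 𝟙 (L j) ℕ.* d j
  above j with L j in Lj
  ... | false = z≤n
  ... | true = ℕₚ.*-monoʳ-≤ 1 (ℕₚ.<⇒≤ (exceeds Lj))
  above-at-i : 𝟙 (L i) ℕ.* K < 𝟙 (L i) ℕ.* d i
  above-at-i rewrite Li = ℕₚ.*-monoʳ-< 1 (exceeds Li)

edges-within≤edges-into : ∀ {m} (L : Fin m → Bool) (M : Fin m → Fin m → Bool) →
  sum (λ j → 𝟙 (L j) ℕ.* count (L ∩ M j)) ≤ sum (λ i → 𝟙 (L i) ℕ.* count (λ j → M j i))
edges-within≤edges-into L M = begin
  sum (λ j → 𝟙 (L j) ℕ.* count (L ∩ M j))
    ≡⟨ sum-cong-≗ (λ j → *-distribˡ-sum (𝟙 (L j)) (𝟙 ∘ (L ∩ M j))) ⟩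
  sum (λ j → sum (λ i → 𝟙 (L j) ℕ.* 𝟙 (L i ∧ M j i)))
    ≤⟨ ∑-mono-≤ (λ j → ∑-mono-≤ (λ i → drop-source (L j) (L i) (M j i))) ⟩
  sum (λ j → sum (λ i → 𝟙 (L i) ℕ.* 𝟙 (M j i)))
    ≡⟨ ∑-comm (λ j i → 𝟙 (L i) ℕ.* 𝟙 (M j i)) ⟩
  sum (λ i → sum (λ j → 𝟙 (L i) ℕ.* 𝟙 (M j i)))
    ≡⟨ sum-cong-≗ (λ i → *-distribˡ-sum (𝟙 (L i)) (λ j → 𝟙 (M j i))) ⟨
  sum (λ i → 𝟙 (L i) ℕ.* count (λ j → M j i)) ∎
  where
  open ℕₚ.≤-Reasoning
  drop-source : ∀ a b c → 𝟙 a ℕ.* 𝟙 (b ∧ c) ≤ 𝟙 b ℕ.* 𝟙 c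
  drop-source false _ _ = z≤n
  drop-source true false _ = z≤n
  drop-source true true _ = ℕₚ.≤-refl

meets? : ∀ {n} (p q : Fin n → Bool) → Dec (∃ λ v → p v ≡ true × q v ≡ true)
meets? p q = any? λ v → (p v ≟ᵇ true) ×-dec (q v ≟ᵇ true)

meets : ∀ {n} → (Fin n → Bool) → (Fin n → Bool) → Bool
meets p q = does (meets? p q)

meets-intro : ∀ {n} (p q : Fin n → Bool) {v} → p v ≡ true → q v ≡ true → meets p q ≡ true
meets-intro p q {v} pv qv = dec-true (meets? p q) (v , pv , qv)

meets-elim : ∀ {n} (p q : Fin n → Bool) → meets p q ≡ true → ∃ λ v → p v ≡ true × q v ≡ true
meets-elim p q = dec-true⁻ (meets? p q)

meets-comm : ∀ {n} (p q : Fin n → Bool) → meets p q ≡ meets q p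
meets-comm p q with meets q p in qp
... | true = let v , qv , pv = meets-elim q p qp in meets-intro p q pv qv
... | false = dec-false (meets? p q) λ (v , pv , qv) →
  contradiction (trans (sym qp) (meets-intro q p qv pv)) λ ()

𝟙-meets≤count : ∀ {n} (p q : Fin n → Bool) → 𝟙 (meets p q) ≤ count (p ∩ q)
𝟙-meets≤count p q with meets p q in pq
... | false = z≤n
... | true = let v , pv , qv = meets-elim p q pq in count-pos {p = p ∩ q} (cong₂ _∧_ pv qv)

count-meets≤ : ∀ {m n} (A : Fin m → Fin n → Bool) (P : Fin m → Bool) (S : Fin n → Bool) t →
  (∀ v → S v ≡ true → count (λ i → P i ∧ A i v) ≤ t) →
  count (λ i → P i ∧ meets (A i) S) ≤ t ℕ.* count S
count-meets≤ A P S t bound = begin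
  count (λ i → P i ∧ meets (A i) S)               ≤⟨ ∑-mono-≤ witnesses ⟩
  sum (λ i → count (λ v → (P i ∧ A i v) ∧ S v))  ≡⟨ ∑-comm (λ i v → 𝟙 ((P i ∧ A i v) ∧ S v)) ⟩
  sum (λ v → count (λ i → (P i ∧ A i v) ∧ S v))  ≤⟨ ∑-mono-≤ per-variable ⟩
  sum (λ v → t ℕ.* 𝟙 (S v))                      ≡⟨ *-distribˡ-sum t (𝟙 ∘ S) ⟨
  t ℕ.* count S                                  ∎
  where
  open ℕₚ.≤-Reasoning
  witnesses : ∀ i → 𝟙 (P i ∧ meets (A i) S) ≤ count (λ v → (P i ∧ A i v) ∧ S v)
  witnesses i with P i
  ... | false = z≤n
  ... | true = 𝟙-meets≤count (A i) S
  per-variable : ∀ v → count (λ i → (P i ∧ A i v) ∧ S v) ≤ t ℕ.* 𝟙 (S v)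
  per-variable v with S v in Sv
  ... | true = ℕₚ.≤-trans (count-mono (λ i h → trans (sym (∧-identityʳ (P i ∧ A i v))) h))
                          (ℕₚ.≤-trans (bound v Sv) (ℕₚ.≤-reflexive (sym (ℕₚ.*-identityʳ t))))
  ... | false = ℕₚ.≤-trans (ℕₚ.≤-reflexive (count-none (λ i → ∧-zeroʳ (P i ∧ A i v)))) z≤n

-- Graphs on Fin m

Independent : ∀ {m} → (Fin m → Fin m → Bool) → (Fin m → Bool) → Set
Independent E J = ∀ {i j} → J i ≡ true → J j ≡ true → i ≢ j → E i j ≡ false

module _ {m} (E : Fin m → Fin m → Bool) where

  degree : (Fin m → Bool) → Fin m → ℕ
  degree L c = count ((L ∖ (_≡ᵇ c)) ∩ E c)

  nonNeighbours : (Fin m → Bool) → Fin m → Fin m → Bool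
  nonNeighbours L c = (L ∖ (_≡ᵇ c)) ∖ E c

  count-nonNeighbours : ∀ {L c} → L c ≡ true → count L ≡ suc (degree L c + count (nonNeighbours L c))
  count-nonNeighbours {L} {c} Lc =
    trans (count-remove {p = L} Lc) (cong suc (count-split (L ∖ (_≡ᵇ c)) (E c)))

  count-nonNeighbours< : ∀ {L c} → L c ≡ true → count (nonNeighbours L c) < count L
  count-nonNeighbours< {L} {c} Lc =
    subst (count (nonNeighbours L c) <_) (sym (count-nonNeighbours Lc)) (s≤s (ℕₚ.m≤n+m _ (degree L c)))

  nonNeighbours⊆ : ∀ {L c} → nonNeighbours L c ⊆ L
  nonNeighbours⊆ {L} {c} i h = proj₁ (∖-true⁻ {L i} (proj₁ (∖-true⁻ {L i ∧ not (i ≡ᵇ c)} h)))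

  c∉nonNeighbours : ∀ {L c} → nonNeighbours L c c ≡ false
  c∉nonNeighbours {L} {c} = ¬-not λ h →
    let c≢c = proj₂ (∖-true⁻ {L c} (proj₁ (∖-true⁻ {L c ∧ not (c ≡ᵇ c)} h))) in
    contradiction (trans (sym (≡ᵇ-refl c)) c≢c) λ ()

module _ {m} {E : Fin m → Fin m → Bool} (E-sym : ∀ i j → E i j ≡ E j i) where

  insert-independent : ∀ {J L c} → J ⊆ nonNeighbours E L c → Independent E J → Independent E (J ∪ (_≡ᵇ c))
  insert-independent {J} {L} {c} J⊆ indep {i} {j} Ji Jj i≢j with ∨-true⁻ Ji | ∨-true⁻ Jj
  ... | inj₁ Ji | inj₁ Jj = indep Ji Jj i≢j
  ... | inj₁ Ji | inj₂ j≡c =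
    trans (cong (E i) (≡ᵇ⇒≡ j≡c)) (trans (E-sym i c) (proj₂ (∖-true⁻ (J⊆ i Ji))))
  ... | inj₂ i≡c | inj₁ Jj = trans (cong (λ k → E k j) (≡ᵇ⇒≡ i≡c)) (proj₂ (∖-true⁻ (J⊆ j Jj)))
  ... | inj₂ i≡c | inj₂ j≡c = contradiction (trans (≡ᵇ⇒≡ i≡c) (sym (≡ᵇ⇒≡ j≡c))) i≢j

  module _ (K : ℕ) (lowDegree : ∀ L {i} → L i ≡ true → ∃ λ c → L c ≡ true × degree E L c ≤ K) where

    greedy : ∀ L → Acc _<_ (count L) → ∃ λ J → J ⊆ L × Independent E J × count L ≤ suc K ℕ.* count J
    greedy L (acc smaller) with any? (λ i → L i ≟ᵇ true)
    ... | no empty = (λ _ → false) , (λ _ ()) , (λ ()) ,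
                     subst (_≤ _) (sym (count-none λ i → ¬-not λ Li → empty (i , Li))) z≤n
    ... | yes (i , Li) with lowDegree L Li
    ... | c , Lc , low with greedy (nonNeighbours E L c) (smaller (count-nonNeighbours< E Lc))
    ... | J , J⊆ , indep , bound = J ∪ (_≡ᵇ c) , J∪c⊆L , insert-independent J⊆ indep , (begin
      count L                                   ≡⟨ count-nonNeighbours E Lc ⟩
      suc (degree E L c + count (nonNeighbours E L c))  ≤⟨ s≤s (ℕₚ.+-mono-≤ low bound) ⟩
      suc (K + suc K ℕ.* count J)               ≡⟨ ℕₚ.*-suc (suc K) (count J) ⟨
      suc K ℕ.* suc (count J)                   ≡⟨ cong (suc K ℕ.*_) (count-insert {p = J} Jc) ⟨
      suc K ℕ.* count (J ∪ (_≡ᵇ c))              ∎)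
      where
      open ℕₚ.≤-Reasoning
      Jc : J c ≡ false
      Jc = ¬-not λ h → contradiction (trans (sym (c∉nonNeighbours E {L})) (J⊆ c h)) λ ()
      J∪c⊆L : J ∪ (_≡ᵇ c) ⊆ L
      J∪c⊆L k h with ∨-true⁻ h
      ... | inj₁ Jk = nonNeighbours⊆ E {L} k (J⊆ k Jk)
      ... | inj₂ k≡c = subst (λ k → L k ≡ true) (sym (≡ᵇ⇒≡ k≡c)) Lc

    independent-set : ∃ λ J → Independent E J × m ≤ suc K ℕ.* count J
    independent-set with greedy (λ _ → true) (<-wellFounded _)
    ... | J , _ , indep , bound = J , indep , subst (_≤ suc K ℕ.* count J) count-all bound

-- Sensitivity

flipBit-same : ∀ {n} (x : Input n) i → lookup (flipBit x i) i ≡ not (lookup x i)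
flipBit-same x i rewrite lookup-zipWith _xor_ i x ⁅ i ⁆ | []=⇒lookup (x∈⁅x⁆ i) with lookup x i
... | true = refl
... | false = refl

flipBit-other : ∀ {n} (x : Input n) {i v} → v ≢ i → lookup (flipBit x i) v ≡ lookup x v
flipBit-other x {i} {v} v≢i
  rewrite lookup-zipWith _xor_ v x ⁅ i ⁆ | ¬-not (x≢y⇒x∉⁅y⁆ v≢i ∘ lookup⇒[]= v ⁅ i ⁆)
  with lookup x v
... | true = refl
... | false = refl

sensitive : ∀ {n} → (Input n → Bool) → Input n → Fin n → Bool
sensitive f x i = f x xor f (flipBit x i)

length-filter-tabulate : ∀ {m a ℓ} {A : Set a} {P : Pred A ℓ} (P? : Decidable P) (g : Fin m → A) →
  List.length (List.filter P? (List.tabulate g)) ≡ count (λ i → does (P? (g i)))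
length-filter-tabulate {zero} P? g = refl
length-filter-tabulate {suc m} P? g with does (P? (g zero))
... | true = cong suc (length-filter-tabulate P? (g ∘ suc))
... | false = length-filter-tabulate P? (g ∘ suc)

sensAt≡count : ∀ {n} (f : Input n → Bool) x → sensAt f x ≡ count (sensitive f x)
sensAt≡count f x =
  trans (length-filter-tabulate (λ i → sensitive f x i ≟ᵇ true) (λ i → i))
        (sum-cong-≗ (λ i → cong 𝟙 (does-≟true (sensitive f x i))))
  where
  does-≟true : ∀ b → does (b ≟ᵇ true) ≡ b
  does-≟true true = refl
  does-≟true false = refl

≤-maxList : ∀ {z zs} → z ∈ zs → z ≤ maxList zs
≤-maxList (here refl) = ℕₚ.m≤m⊔n _ _
≤-maxList (there z∈zs) = ℕₚ.≤-trans (≤-maxList z∈zs) (ℕₚ.m≤n⊔m _ _)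

maxList-map≤ : ∀ {A : Set} (g : A → ℕ) {c} xs → (∀ x → g x ≤ c) → maxList (List.map g xs) ≤ c
maxList-map≤ g [] _ = z≤n
maxList-map≤ g (x ∷ xs) g≤c = ℕₚ.⊔-lub (g≤c x) (maxList-map≤ g xs g≤c)

∈-allInputs : ∀ {n} (x : Input n) → x ∈ allInputs n
∈-allInputs [] = here refl
∈-allInputs (true ∷ x) = ∈-++⁺ˡ (∈-map⁺ (true ∷_) (∈-allInputs x))
∈-allInputs (false ∷ x) = ∈-++⁺ʳ _ (∈-map⁺ (false ∷_) (∈-allInputs x))

sensAt≤sens : ∀ {n} (f : Input n → Bool) x → sensAt f x ≤ sens f
sensAt≤sens f x = ≤-maxList (∈-map⁺ (sensAt f) (∈-allInputs x))

sens-false : ∀ {n} → sens {n} (λ _ → false) ≡ 0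
sens-false {n} = ℕₚ.n≤0⇒n≡0 (maxList-map≤ (sensAt f) (allInputs n) λ x →
  ℕₚ.≤-reflexive (trans (sensAt≡count f x) (count-none {n} λ _ → refl)))
  where
  f : Input n → Bool
  f _ = false

record MaximalZero {n} (f : Input n → Bool) (y : Fin n → Bool) (x : Input n) : Set where
  field
    below   : lookup x ⊆ y
    isZero  : f x ≡ false
    maximal : ∀ v → y v ≡ true → lookup x v ≡ false → f (flipBit x v) ≡ true

module _ {n} (f : Input n → Bool) (y : Fin n → Bool) where

  flipBit-⊆ : ∀ {x v} → lookup x ⊆ y → y v ≡ true → lookup (flipBit x v) ⊆ y
  flipBit-⊆ {x} {v} x⊆y yv u h with u ≟ v
  ... | yes refl = yv
  ... | no u≢v = x⊆y u (trans (sym (flipBit-other x u≢v)) h)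

  flipBit-shrinks : ∀ {x v} → y v ≡ true → lookup x v ≡ false →
    count (y ∖ lookup (flipBit x v)) < count (y ∖ lookup x)
  flipBit-shrinks {x} {v} yv xv = begin-strict
    count (y ∖ lookup (flipBit x v))       ≤⟨ count-mono inside ⟩
    count ((y ∖ lookup x) ∖ (_≡ᵇ v))        <⟨ ℕₚ.n<1+n _ ⟩
    suc (count ((y ∖ lookup x) ∖ (_≡ᵇ v)))
      ≡⟨ count-remove {p = y ∖ lookup x} (cong₂ (λ a b → a ∧ not b) yv xv) ⟨
    count (y ∖ lookup x)                   ∎
    where
    open ℕₚ.≤-Reasoning
    inside : y ∖ lookup (flipBit x v) ⊆ (y ∖ lookup x) ∖ (_≡ᵇ v)
    inside u h with u ≟ v | ∖-true⁻ h
    ... | yes refl | _ , unset = contradiction (trans (sym unset) (trans (flipBit-same x u) (cong not xv))) λ ()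
    ... | no u≢v | yu , unset = cong₂ (λ a b → (a ∧ not b) ∧ true) yu (trans (sym (flipBit-other x u≢v)) unset)

  maximalZero : ∀ {x} → f x ≡ false → lookup x ⊆ y → ∃ (MaximalZero f y)
  maximalZero {x} fx x⊆y = climb x fx x⊆y (<-wellFounded _)
    where
    climb : ∀ x → f x ≡ false → lookup x ⊆ y → Acc _<_ (count (y ∖ lookup x)) → ∃ (MaximalZero f y)
    climb x fx x⊆y (acc smaller)
      with any? (λ v → (y v ≟ᵇ true) ×-dec (lookup x v ≟ᵇ false) ×-dec (f (flipBit x v) ≟ᵇ false))
    ... | yes (v , yv , xv , fxv) =
      climb (flipBit x v) fxv (flipBit-⊆ {x} x⊆y yv) (smaller (flipBit-shrinks {x} yv xv))
    ... | no stuck = x , record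
      { below = x⊆y ; isZero = fx ; maximal = λ v yv xv → ¬-not λ fxv → stuck (v , yv , xv , fxv) }

  maximalZero-sensitive : ∀ {x} → MaximalZero f y x → count (y ∖ lookup x) ≤ sensAt f x
  maximalZero-sensitive {x} mz = ℕₚ.≤-trans (count-mono flips) (ℕₚ.≤-reflexive (sym (sensAt≡count f x)))
    where
    open MaximalZero mz
    flips : y ∖ lookup x ⊆ sensitive f x
    flips v h = let yv , xv = ∖-true⁻ h in cong₂ _xor_ isZero (maximal v yv xv)

-- DNFs

card≡count : ∀ {n} (p : Subset n) → ∣ p ∣ ≡ count (lookup p)
card≡count [] = refl
card≡count (true ∷ p) = cong suc (card≡count p)
card≡count (false ∷ p) = card≡count p

foldr-+-map : ∀ {A : Set} {m} (g : A → ℕ) (xs : Vec A m) → foldr _ _+_ 0 (Vec.map g xs) ≡ sum (g ∘ lookup xs)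
foldr-+-map g [] = refl
foldr-+-map g (x ∷ xs) = cong (λ k → g x + k) (foldr-+-map g xs)

≤-foldr-⊔-map : ∀ {A : Set} {m} (g : A → ℕ) (xs : Vec A m) j →
  g (lookup xs j) ≤ foldr _ _⊔_ 0 (Vec.map g xs)
≤-foldr-⊔-map g (x ∷ xs) zero = ℕₚ.m≤m⊔n _ _
≤-foldr-⊔-map g (x ∷ xs) (suc j) = ℕₚ.≤-trans (≤-foldr-⊔-map g xs j) (ℕₚ.m≤n⊔m _ _)

evalTerm-true : ∀ {n} (T : Term n) {x : Input n} → lookup (pos T) ⊆ lookup x →
  (∀ v → lookup (neg T) v ≡ true → lookup x v ≡ false) → evalTerm T x ≡ true
evalTerm-true T {x} = clauses-true (pos T) (neg T) x
  where
  clause : ∀ a c b → (a ≡ true → b ≡ true) → (c ≡ true → b ≡ false) →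
    (not a ∨ b) ∧ (not c ∨ not b) ≡ true
  clause false false b _ _ = refl
  clause false true b _ c⇒¬b rewrite c⇒¬b refl = refl
  clause true false b a⇒b _ rewrite a⇒b refl = refl
  clause true true b a⇒b c⇒¬b = contradiction (trans (sym (a⇒b refl)) (c⇒¬b refl)) λ ()
  clauses-true : ∀ {n} (p q x : Vec Bool n) → lookup p ⊆ lookup x →
    (∀ v → lookup q v ≡ true → lookup x v ≡ false) →
    foldr _ _∧_ true
      (zipWith _∧_ (zipWith (λ p b → not p ∨ b) p x) (zipWith (λ q b → not q ∨ not b) q x)) ≡ true
  clauses-true [] [] [] _ _ = refl
  clauses-true (a ∷ p) (c ∷ q) (b ∷ x) p⊆x q-off =
    cong₂ _∧_ (clause a c b (p⊆x zero) (q-off zero)) (clauses-true p q x (p⊆x ∘ suc) (q-off ∘ suc))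

evalDNF-true : ∀ {n m} (D : DNF n m) {x} j → evalTerm (lookup D j) x ≡ true → evalDNF D x ≡ true
evalDNF-true (T ∷ D) zero h rewrite h = refl
evalDNF-true (T ∷ D) (suc j) h rewrite evalDNF-true D j h = ∨-zeroʳ _

-- suc (degreeBound t w) = 3(t+1)(w+1) − 2(t+1) − (w+1) + 1, the denominator of the bound.
degreeBound : ℕ → ℕ → ℕ
degreeBound t w = t ℕ.* (3 ℕ.* w) + t + 2 ℕ.* w

degreeBound-slack : ∀ t a ā r → t ℕ.* suc a + suc t ℕ.* ā + suc t ℕ.* ā
  + (2 ℕ.* t ℕ.* a + t ℕ.* ā + 3 ℕ.* t ℕ.* r + 2 ℕ.* a + 2 ℕ.* r)
  ≡ t ℕ.* (3 ℕ.* (a + ā + r)) + t + 2 ℕ.* (a + ā + r)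
degreeBound-slack = solve-∀

weighted-width≤degreeBound : ∀ t w {a ā} → 1 ≤ a → a + ā ≤ suc w →
  t ℕ.* a + suc t ℕ.* ā + suc t ℕ.* ā ≤ degreeBound t w
weighted-width≤degreeBound t w {suc a} {ā} _ (s≤s a+ā≤w) with ℕₚ.m≤n⇒∃[o]m+o≡n a+ā≤w
... | r , refl = ℕₚ.≤-trans (ℕₚ.m≤m+n _ _) (ℕₚ.≤-reflexive (degreeBound-slack t a ā r))

module _ {n m} (D : DNF n m) where

  A Ā : Fin m → Fin n → Bool
  A j = lookup (pos (lookup D j))
  Ā j = lookup (neg (lookup D j))

  A∩Ā-empty : ∀ {j v} → A j v ≡ true → Ā j v ≡ true → ⊥
  A∩Ā-empty {j} {v} Ajv Ājv =
    consistent (lookup D j) (v , x∈p∩q⁺ (lookup⇒[]= v _ Ajv , lookup⇒[]= v _ Ājv))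

  satisfies : ∀ {x} j → A j ⊆ lookup x → (∀ v → Ā j v ≡ true → lookup x v ≡ false) →
    evalDNF D x ≡ true
  satisfies j A⊆x Ā-off = evalDNF-true D j (evalTerm-true (lookup D j) A⊆x Ā-off)

  tBlock⇒count≤ : ∀ {t} → tBlock t D → ∀ v → count (λ i → A i v) ≤ t
  tBlock⇒count≤ {t} t-block v = subst (_≤ t) (foldr-+-map (λ T → 𝟙 (lookup (pos T) v)) D) (t-block v)

  width≥ : ∀ j → count (A j) + count (Ā j) ≤ width D
  width≥ j = subst (_≤ width D) (cong₂ _+_ (card≡count (pos (lookup D j))) (card≡count (neg (lookup D j))))
                   (≤-foldr-⊔-map (λ T → ∣ pos T ∣ + ∣ neg T ∣) D j)

  positive-nonempty : evalDNF D (zeros n) ≡ false → ∀ j → 1 ≤ count (A j)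
  positive-nonempty zero-false j = 1≤count λ none →
    contradiction (trans (sym zero-false) (satisfies j (λ v Ajv → contradiction (trans (sym Ajv) (none v)) λ ())
                                                       (λ v _ → lookup-replicate v false))) λ ()

  width-positive : evalDNF D (zeros n) ≡ false → ∀ j → 1 ≤ width D
  width-positive zero-false j =
    ℕₚ.≤-trans (positive-nonempty zero-false j) (ℕₚ.≤-trans (ℕₚ.m≤m+n _ _) (width≥ j))

  -- The last two disjuncts say that terms i and j contradict each other.
  conflict : Fin m → Fin m → Bool
  conflict i j = meets (A j) (A i) ∨ (meets (A j) (Ā i) ∨ meets (A i) (Ā j))

  conflict-sym : ∀ i j → conflict i j ≡ conflict j i
  conflict-sym i j = cong₂ _∨_ (meets-comm (A j) (A i)) (∨-comm (meets (A j) (Ā i)) (meets (A i) (Ā j)))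

  module _ {J : Fin m → Bool} (indep : Independent conflict J) where

    positive-disjoint : ∀ {i j v} → J i ≡ true → J j ≡ true → A i v ≡ true → A j v ≡ true → i ≡ j
    positive-disjoint {i} {j} Ji Jj Aiv Ajv with i ≟ j
    ... | yes i≡j = i≡j
    ... | no i≢j = contradiction (trans (sym (indep Ji Jj i≢j)) shared) λ ()
      where
      shared : conflict i j ≡ true
      shared = cong (_∨ (meets (A j) (Ā i) ∨ meets (A i) (Ā j))) (meets-intro (A j) (A i) Ajv Aiv)

    unblocked : ∀ {i j v} → J i ≡ true → J j ≡ true → A i v ≡ true → Ā j v ≡ true → ⊥
    unblocked {i} {j} Ji Jj Aiv Ājv with j ≟ i
    ... | yes refl = A∩Ā-empty Aiv Ājv
    ... | no j≢i = contradiction (trans (sym (indep Jj Ji j≢i)) blocked) λ ()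
      where
      blocked : conflict j i ≡ true
      blocked = trans (cong (λ b → meets (A i) (A j) ∨ (b ∨ meets (A j) (Ā i)))
                            (meets-intro (A i) (Ā j) Aiv Ājv))
                      (∨-zeroʳ (meets (A i) (A j)))

    covered : Fin n → Bool
    covered v = meets J (λ j → A j v)

    -- Each term of J keeps an unset variable of its own at the 0-input x.
    count≤missing : ∀ {x} → lookup x ⊆ covered → evalDNF D x ≡ false →
      count J ≤ count (covered ∖ lookup x)
    count≤missing {x} x⊆covered fx = begin
      count J                               ≤⟨ ∑-mono-≤ unset ⟩
      sum (λ j → count (λ v → U j v))       ≡⟨ ∑-comm (λ j v → 𝟙 (U j v)) ⟩
      sum (λ v → count (λ j → U j v))       ≤⟨ ∑-mono-≤ (λ v → count≤𝟙 unique (implies v)) ⟩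
      count (covered ∖ lookup x)            ∎
      where
      open ℕₚ.≤-Reasoning
      U : Fin m → Fin n → Bool
      U j v = J j ∧ (A j v ∧ not (lookup x v))
      unset : ∀ j → 𝟙 (J j) ≤ count (U j)
      unset j with J j in Jj
      ... | false = z≤n
      ... | true = 1≤count λ allSet → contradiction (trans (sym fx) (satisfies j (A⊆x allSet) Ā-off)) λ ()
        where
        A⊆x : (∀ v → A j v ∧ not (lookup x v) ≡ false) → A j ⊆ lookup x
        A⊆x allSet v Ajv = not-injective (trans (sym (cong (λ a → a ∧ not (lookup x v)) Ajv)) (allSet v))
        Ā-off : ∀ v → Ā j v ≡ true → lookup x v ≡ false
        Ā-off v Ājv = ¬-not λ xv →
          let i , Ji , Aiv = meets-elim J (λ j → A j v) (x⊆covered v xv) in unblocked Ji Jj Aiv Ājv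
      unique : ∀ {v i j} → U i v ≡ true → U j v ≡ true → i ≡ j
      unique hi hj =
        let Ji , rest-i = ∧-true⁻ hi ; Jj , rest-j = ∧-true⁻ hj in
        positive-disjoint Ji Jj (proj₁ (∧-true⁻ rest-i)) (proj₁ (∧-true⁻ rest-j))
      implies : ∀ v j → U j v ≡ true → (covered ∖ lookup x) v ≡ true
      implies v j h =
        let Jj , rest = ∧-true⁻ h ; Ajv , xv = ∖-true⁻ rest in
        cong₂ (λ a b → a ∧ not b) (meets-intro J (λ j → A j v) Jj Ajv) xv

    zeros⊆covered : lookup (zeros n) ⊆ covered
    zeros⊆covered v h = contradiction (trans (sym (lookup-replicate v false)) h) λ ()

    count≤sens : evalDNF D (zeros n) ≡ false → count J ≤ sens (evalDNF D)
    count≤sens zero-false with maximalZero (evalDNF D) covered zero-false zeros⊆covered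
    ... | x , mz = ℕₚ.≤-trans (count≤missing below isZero)
                     (ℕₚ.≤-trans (maximalZero-sensitive (evalDNF D) covered mz) (sensAt≤sens (evalDNF D) x))
      where open MaximalZero mz

  sharers blockers : Fin m → ℕ
  sharers j = count (λ i → not (i ≡ᵇ j) ∧ meets (A i) (A j))
  blockers j = count (λ i → meets (A i) (Ā j))

  degree-conflict≤ : ∀ L j →
    degree conflict L j ≤ sharers j + blockers j + count (L ∩ (λ i → meets (A j) (Ā i)))
  degree-conflict≤ L j = ℕₚ.≤-trans
    (∑-mono-≤ (λ i → split (L i) (i ≡ᵇ j) (meets (A i) (A j)) (meets (A i) (Ā j)) (meets (A j) (Ā i))))
    (ℕₚ.≤-reflexive (trans (∑-distrib-+ (λ i → S i + B i) B′) (cong (_+ sum B′) (∑-distrib-+ S B))))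
    where
    S B B′ : Fin m → ℕ
    S i = 𝟙 (not (i ≡ᵇ j) ∧ meets (A i) (A j))
    B i = 𝟙 (meets (A i) (Ā j))
    B′ i = 𝟙 (L i ∧ meets (A j) (Ā i))
    split : ∀ l e s b b′ → 𝟙 ((l ∧ not e) ∧ (s ∨ (b ∨ b′))) ≤ 𝟙 (not e ∧ s) + 𝟙 b + 𝟙 (l ∧ b′)
    split false _ _ _ _ = z≤n
    split true true _ _ _ = z≤n
    split true false true _ _ = s≤s z≤n
    split true false false true _ = s≤s z≤n
    split true false false false _ = ℕₚ.≤-refl

  module _ (t w : ℕ) (t-block : ∀ v → count (λ i → A i v) ≤ suc t)
           (nonempty : ∀ j → 1 ≤ count (A j)) (narrow : ∀ j → count (A j) + count (Ā j) ≤ suc w) where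

    sharers≤ : ∀ j → sharers j ≤ t ℕ.* count (A j)
    sharers≤ j = count-meets≤ A (λ i → not (i ≡ᵇ j)) (A j) t λ v Ajv →
      ℕₚ.≤-trans (count-mono (λ i h → trans (∧-comm (A i v) (not (i ≡ᵇ j))) h))
                 (ℕₚ.≤-pred (subst (_≤ suc t) (count-remove {p = λ i → A i v} Ajv) (t-block v)))

    blockers≤ : ∀ j → blockers j ≤ suc t ℕ.* count (Ā j)
    blockers≤ j = count-meets≤ A (λ _ → true) (Ā j) (suc t) (λ v _ → t-block v)

    -- An edge j → i inside L with A j ∩ Ā i nonempty is charged to i, as one of its blockers.
    average-degree : ∀ L → sum (λ j → 𝟙 (L j) ℕ.* degree conflict L j) ≤ count L ℕ.* degreeBound t w
    average-degree L = begin
      sum (λ j → 𝟙 (L j) ℕ.* degree conflict L j)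
        ≤⟨ ∑-mono-≤ (λ j → ℕₚ.*-monoʳ-≤ (𝟙 (L j)) (degree-conflict≤ L j)) ⟩
      sum (λ j → 𝟙 (L j) ℕ.* (own j + inner j))
        ≡⟨ ∑-*-distribˡ-+ (𝟙 ∘ L) own inner ⟩
      sum (λ j → 𝟙 (L j) ℕ.* own j) + sum (λ j → 𝟙 (L j) ℕ.* inner j)
        ≤⟨ ℕₚ.+-monoʳ-≤ (sum (λ j → 𝟙 (L j) ℕ.* own j))
                        (edges-within≤edges-into L (λ j i → meets (A j) (Ā i))) ⟩
      sum (λ j → 𝟙 (L j) ℕ.* own j) + sum (λ j → 𝟙 (L j) ℕ.* blockers j)
        ≡⟨ ∑-*-distribˡ-+ (𝟙 ∘ L) own blockers ⟨
      sum (λ j → 𝟙 (L j) ℕ.* (own j + blockers j))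
        ≤⟨ ∑-mono-≤ (λ j → ℕₚ.*-monoʳ-≤ (𝟙 (L j)) (per-term j)) ⟩
      sum (λ j → 𝟙 (L j) ℕ.* degreeBound t w)
        ≡⟨ *-distribʳ-sum (degreeBound t w) (𝟙 ∘ L) ⟨
      count L ℕ.* degreeBound t w ∎
      where
      open ℕₚ.≤-Reasoning
      own inner : Fin m → ℕ
      own j = sharers j + blockers j
      inner j = count (L ∩ (λ i → meets (A j) (Ā i)))
      per-term : ∀ j → own j + blockers j ≤ degreeBound t w
      per-term j = ℕₚ.≤-trans (ℕₚ.+-mono-≤ (ℕₚ.+-mono-≤ (sharers≤ j) (blockers≤ j)) (blockers≤ j))
                              (weighted-width≤degreeBound t w (nonempty j) (narrow j))

    large-independent-set : ∃ λ J → Independent conflict J × m ≤ suc (degreeBound t w) ℕ.* count J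
    large-independent-set = independent-set conflict-sym (degreeBound t w) λ L Li →
      below-average L (degree conflict L) (degreeBound t w) Li (average-degree L)

  m≤sens*[1+degreeBound] : ∀ t w → evalDNF D (zeros n) ≡ false → (∀ v → count (λ i → A i v) ≤ suc t) →
    (∀ j → count (A j) + count (Ā j) ≤ suc w) → m ≤ sens (evalDNF D) ℕ.* suc (degreeBound t w)
  m≤sens*[1+degreeBound] t w zero-false t-block narrow
    with large-independent-set t w t-block (positive-nonempty zero-false) narrow
  ... | J , indep , m≤ = begin
    m                                     ≤⟨ m≤ ⟩
    suc K ℕ.* count J                     ≤⟨ ℕₚ.*-monoʳ-≤ (suc K) (count≤sens indep zero-false) ⟩
    suc K ℕ.* sens (evalDNF D)            ≡⟨ ℕₚ.*-comm (suc K) (sens (evalDNF D)) ⟩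
    sens (evalDNF D) ℕ.* suc K            ∎
    where
    open ℕₚ.≤-Reasoning
    K = degreeBound t w

degreeBound-ℤ : ∀ t w →
  + (3 ℕ.* suc t ℕ.* suc w) - + (2 ℕ.* suc t) - + suc w +ℤ + 1 ≡ + suc (degreeBound t w)
degreeBound-ℤ t w = begin
  + (3 ℕ.* suc t ℕ.* suc w) - + a - + b +ℤ + 1  ≡⟨ cong (λ k → + k - + a - + b +ℤ + 1) (expand t w) ⟩
  + (a + b + c) - + a - + b +ℤ + 1              ≡⟨ cong (λ z → z - + a - + b +ℤ + 1) pos-+-+ ⟩
  + a +ℤ + b +ℤ + c - + a - + b +ℤ + 1          ≡⟨ cancel (+ a) (+ b) (+ c) ⟩
  + c +ℤ + 1                                   ≡⟨ ℤₚ.pos-+ c 1 ⟨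
  + (c + 1)                                    ≡⟨ cong +_ (ℕₚ.+-comm c 1) ⟩
  + suc c                                      ∎
  where
  open ≡-Reasoning
  a = 2 ℕ.* suc t
  b = suc w
  c = degreeBound t w
  pos-+-+ : + (a + b + c) ≡ + a +ℤ + b +ℤ + c
  pos-+-+ = trans (ℤₚ.pos-+ (a + b) c) (cong (_+ℤ + c) (ℤₚ.pos-+ a b))
  expand : ∀ t w → 3 ℕ.* suc t ℕ.* suc w ≡ 2 ℕ.* suc t + suc w + (t ℕ.* (3 ℕ.* w) + t + 2 ℕ.* w)
  expand = solve-∀
  cancel : ∀ x y z → x +ℤ y +ℤ z - x - y +ℤ + 1 ≡ z +ℤ + 1
  cancel = ℤ-Solver.solve-∀

lemma8 : ∀ {n m : ℕ} (t : ℕ) (D : DNF n m) → 1 ≤ t → CompactForm D → tBlock t D →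
    + m ≤ℤ + sens (evalDNF D) * (+ (3 Data.Nat.* t Data.Nat.* width D) - + (2 Data.Nat.* t) - + width D +ℤ + 1)
-- Without terms f is constant; the factor on the right is then 1 − 2t < 0.
lemma8 {n} {zero} t [] _ _ _ rewrite sens-false {n} = ℤ.+≤+ z≤n
lemma8 {n} {suc m} (suc t) D _ compact t-block with width D in width≡
... | zero = contradiction (subst (1 ≤_) width≡ (width-positive D (CompactForm.zeroAtZero compact) zero)) λ ()
... | suc w = subst (λ E → + suc m ≤ℤ + sens (evalDNF D) * E) (sym (degreeBound-ℤ t w))
                (subst (+ suc m ≤ℤ_) (ℤₚ.pos-* (sens (evalDNF D)) (suc (degreeBound t w)))
                  (ℤ.+≤+ (m≤sens*[1+degreeBound] D t w (CompactForm.zeroAtZero compact)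
                                                  (tBlock⇒count≤ D t-block) narrow)))
  where
  narrow : ∀ j → count (A D j) + count (Ā D j) ≤ suc w
  narrow j = subst (count (A D j) + count (Ā D j) ≤_) width≡ (width≥ D j)
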